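{- Every minimal cover of a Latin square of order $n$ has size at most $\lfloor 3(n+1/2 - \sqrt{n+1/4})\rfloor$.
   Context: A Latin square of order $n$ is an $n\times n$ array on $n$ symbols in which each symbol occurs once in each row and each column; its entries are the triples $(i,j,L_{ij})$. A line is the set of all entries in a given row, in a given column, or with a given symbol. A cover is a set of entries meeting every line. A cover $\mathscr{C}$ is minimal if for every entry $\mathbf{e}\in\mathscr{C}$ the set $\mathscr{C}\setminus\{\mathbf{e}\}$ is not a cover. -}

module Defs where

open import Data.Nat using (ℕ; _+_; _*_; _∸_; _≤_)
open import Data.Fin using (Fin; _≟_)
open import Data.Bool using (Bool; true; false; if_then_else_; _∧_)
open import Data.List using (map; allFin)
open import Data.Nat.ListAction using (sum)
open import Data.Product using (Σ; _×_; ∃; ∃₂)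
open import Relation.Binary.PropositionalEquality using (_≡_)
open import Relation.Nullary using (¬_)
open import Relation.Nullary.Decidable using (⌊_⌋)
open import Function.Definitions using (Bijective)

Square : ℕ → Set
Square n = Fin n → Fin n → Fin n

IsLatin : ∀ {n} → Square n → Set
IsLatin {n} L =
  (∀ i → Bijective _≡_ _≡_ (λ j → L i j)) ×
  (∀ j → Bijective _≡_ _≡_ (λ i → L i j))

-- A set of entries. Since an entry (i , j , L i j) is determined by its cell,
-- a set of entries is a subset of cells, given by its characteristic function.
EntrySet : ℕ → Set
EntrySet n = Fin n → Fin n → Bool

size : ∀ {n} → EntrySet n → ℕ
size {n} C = sum (map (λ i → sum (map (λ j → if C i j then 1 else 0) (allFin n))) (allFin n))

IsCover : ∀ {n} → Square n → EntrySet n → Set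
IsCover {n} L C =
  (∀ (i : Fin n) → ∃ λ j → C i j ≡ true) ×
  (∀ (j : Fin n) → ∃ λ i → C i j ≡ true) ×
  (∀ (s : Fin n) → ∃₂ λ i j → (C i j ≡ true) × (L i j ≡ s))

remove : ∀ {n} → EntrySet n → Fin n → Fin n → EntrySet n
remove C a b i j = if ⌊ i ≟ a ⌋ ∧ ⌊ j ≟ b ⌋ then false else C i j

IsMinimalCover : ∀ {n} → Square n → EntrySet n → Set
IsMinimalCover L C =
  IsCover L C × (∀ a b → C a b ≡ true → ¬ IsCover L (remove C a b))

-- k ≤ ⌊ 3 (n + 1/2 - √(n + 1/4)) ⌋, expressed in ℕ.
-- Since 3(n + 1/2 - √(n+1/4)) = (6n + 3 - 3√(4n+1)) / 2, for integer k this
-- holds iff 3√(4n+1) ≤ 6n + 3 - 2k, i.e. iff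
--   2k ≤ 6n + 3  and  9(4n+1) ≤ (6n + 3 - 2k)².
AtMostBound : ℕ → ℕ → Set
AtMostBound n k =
  (2 * k ≤ 6 * n + 3) ×
  (9 * (4 * n + 1) ≤ (6 * n + 3 ∸ 2 * k) * (6 * n + 3 ∸ 2 * k))

-- Call a line critical for a cover C if it contains exactly one entry of C.  By
-- minimality every entry of C lies on a critical line, for otherwise it could be removed.
-- Let k = |C|, let X, Y, Z be the numbers of critical rows, columns and symbols and
-- x, y, z the numbers of the other lines (X + x = Y + y = Z + z = n).  Double counting
-- entries against lines gives
--   k ≤ X + Y + Z                   (each critical line carries a single entry),
--   2k ≤ X + Y + Z + yz + xz + xy   (an entry on just one critical line lies on two
--                                    non-critical lines of different kinds, and in a Latin
--                                    square two such lines share exactly one cell),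
-- and elementary arithmetic turns these into 3k ≤ (3n − k)², which is the bound.
module Submission where

open import Defs

open import Data.Nat using (ℕ; zero; suc; _+_; _*_; _∸_; _≤_; z≤n; s≤s)
open import Data.Nat.Properties hiding (_≟_)
import Data.Nat.Properties as ℕ using (_≟_)
open import Data.Nat.Tactic.RingSolver using (solve-∀; solve)
open import Data.List using ([]; _∷_)
import Data.List as List using (map; tabulate)
open import Data.Nat.ListAction using () renaming (sum to listSum)
open import Data.Fin using (Fin; zero; suc; punchIn; _≟_)
open import Data.Fin.Properties using (punchInᵢ≢i; any?)
open import Algebra.Properties.Semiring.Sum +-*-semiring
  using (sum-syntax; ∑-distrib-+; ∑-comm; ∑-permute; sum-remove; sum-cong-≗; sum-replicate-zero;
         *-distribˡ-sum; *-distribʳ-sum)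
open import Function using (_∘_; id; case_of_)
open import Function.Bundles using (mk⤖)
open import Function.Properties.Bijection using (⤖⇒↔)
open import Function.Definitions using (Bijective)
open import Function.Construct.Identity using (bijective)
open import Data.Product using (_,_; _×_; proj₁; proj₂; ∃; ∃₂)
open import Data.Bool using (Bool; true; false; if_then_else_; _∧_; _∨_; not)
open import Data.Bool.Properties using (∧-zeroʳ; ∧-identityʳ)
import Data.Bool.Properties as Bool using (_≟_)
open import Data.Sum using (inj₁; inj₂)
open import Data.Nat.DivMod using (_%_; m*n%n≡0)
open import Relation.Binary.PropositionalEquality
open import Relation.Nullary using (¬_; yes; no; contradiction)
open import Relation.Nullary.Decidable using (⌊_⌋; ¬?; _×-dec_)

-- 2xy ≤ x² + y², proved in ℕ by writing the larger of x, y as the smaller plus t.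
two-mul-≤-squares : ∀ x y → 2 * (x * y) ≤ x * x + y * y
two-mul-≤-squares x y with ≤-total y x
... | inj₁ y≤x with m≤n⇒∃[o]m+o≡n y≤x
...   | t , refl = subst (2 * ((y + t) * y) ≤_) (expand y t) (m≤m+n _ (t * t))
  where
  expand : ∀ y t → 2 * ((y + t) * y) + t * t ≡ (y + t) * (y + t) + y * y
  expand = solve-∀
two-mul-≤-squares x y | inj₂ x≤y with m≤n⇒∃[o]m+o≡n x≤y
...   | t , refl = subst (2 * (x * (x + t)) ≤_) (expand x t) (m≤m+n _ (t * t))
  where
  expand : ∀ x t → 2 * (x * (x + t)) + t * t ≡ x * x + (x + t) * (x + t)
  expand = solve-∀

three-products-≤-square : ∀ x y z → 3 * (y * z + x * z + x * y) ≤ (x + y + z) * (x + y + z)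
three-products-≤-square x y z =
  subst₂ _≤_ (expand₁ x y z) (expand₂ x y z) (+-monoʳ-≤ (2 * (y * z + x * z + x * y)) products≤squares)
  where
  products≤squares : y * z + x * z + x * y ≤ x * x + y * y + z * z
  products≤squares = *-cancelˡ-≤ 2 (subst₂ _≤_ (double₁ x y z) (double₂ x y z)
    (+-mono-≤ (+-mono-≤ (two-mul-≤-squares y z) (two-mul-≤-squares x z)) (two-mul-≤-squares x y)))
    where
    double₁ : ∀ x y z → 2 * (y * z) + 2 * (x * z) + 2 * (x * y) ≡ 2 * (y * z + x * z + x * y)
    double₁ = solve-∀
    double₂ : ∀ x y z → (y * y + z * z) + (x * x + z * z) + (x * x + y * y) ≡ 2 * (x * x + y * y + z * z)
    double₂ = solve-∀
  expand₁ : ∀ x y z → 2 * (y * z + x * z + x * y) + (y * z + x * z + x * y) ≡ 3 * (y * z + x * z + x * y)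
  expand₁ = solve-∀
  expand₂ : ∀ x y z → 2 * (y * z + x * z + x * y) + (x * x + y * y + z * z) ≡ (x + y + z) * (x + y + z)
  expand₂ = solve-∀

-- The bound AtMostBound n k holds as soon as 3k ≤ m² for the complement m = 3n − k:
-- then 6n + 3 − 2k = 2m + 3 and 9(4n + 1) = 4·3k + 12m + 9 ≤ (2m + 3)².
bound-from-square : ∀ n k m → k + m ≡ 3 * n → 3 * k ≤ m * m → AtMostBound n k
bound-from-square n k m k+m≡3n 3k≤m² = 2k≤6n+3 , target≤square
  where
  6n+3≡ : 6 * n + 3 ≡ 2 * k + (2 * m + 3)
  6n+3≡ = begin
    6 * n + 3           ≡⟨ solve (n ∷ []) ⟩
    2 * (3 * n) + 3     ≡⟨ cong (λ t → 2 * t + 3) (sym k+m≡3n) ⟩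
    2 * (k + m) + 3     ≡⟨ solve (k ∷ m ∷ []) ⟩
    2 * k + (2 * m + 3) ∎
    where open ≡-Reasoning

  2k≤6n+3 : 2 * k ≤ 6 * n + 3
  2k≤6n+3 = subst (2 * k ≤_) (sym 6n+3≡) (m≤m+n (2 * k) _)

  9[4n+1]≡ : 9 * (4 * n + 1) ≡ 4 * (3 * k) + (12 * m + 9)
  9[4n+1]≡ = begin
    9 * (4 * n + 1)            ≡⟨ solve (n ∷ []) ⟩
    12 * (3 * n) + 9           ≡⟨ cong (λ t → 12 * t + 9) (sym k+m≡3n) ⟩
    12 * (k + m) + 9           ≡⟨ solve (k ∷ m ∷ []) ⟩
    4 * (3 * k) + (12 * m + 9) ∎
    where open ≡-Reasoning

  target≤square : 9 * (4 * n + 1) ≤ (6 * n + 3 ∸ 2 * k) * (6 * n + 3 ∸ 2 * k)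
  target≤square rewrite 6n+3≡ | m+n∸m≡n (2 * k) (2 * m + 3) =
    subst₂ _≤_ (sym 9[4n+1]≡) (square m) (+-monoˡ-≤ (12 * m + 9) (*-monoʳ-≤ 4 3k≤m²))
    where
    square : ∀ m → 4 * (m * m) + (12 * m + 9) ≡ (2 * m + 3) * (2 * m + 3)
    square = solve-∀

three-k-≤-square-generic : ∀ k d s q → k ≤ d + q → 3 * q ≤ s * s → 3 * d ≤ d * d + 2 * d * s →
                           3 * k ≤ (d + s) * (d + s)
three-k-≤-square-generic k d s q k≤d+q 3q≤s² 3d≤ = begin
  3 * k                    ≤⟨ *-monoʳ-≤ 3 k≤d+q ⟩
  3 * (d + q)              ≡⟨ *-distribˡ-+ 3 d q ⟩
  3 * d + 3 * q            ≤⟨ +-mono-≤ 3d≤ 3q≤s² ⟩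
  d * d + 2 * d * s + s * s ≡⟨ square d s ⟩
  (d + s) * (d + s)        ∎
  where
  open ≤-Reasoning
  square : ∀ d s → d * d + 2 * d * s + s * s ≡ (d + s) * (d + s)
  square = solve-∀

multiple-of-three-mod : ∀ n {r} → 3 * n ≡ r → r % 3 ≡ 0
multiple-of-three-mod n refl = trans (cong (_% 3) (*-comm 3 n)) (m*n%n≡0 n 3)

-- Generically
-- 3k ≤ 3d + s² ≤ (d + s)², which needs 3d ≤ d² + 2ds; this fails only for s = 0
-- and d ∈ {1, 2}, where q = 0 and divisibility by 3 excludes k = d.
three-k-≤-square : ∀ n k d s q → k ≤ d + q → 3 * q ≤ s * s → k + d + s ≡ 3 * n →
                   3 * k ≤ (d + s) * (d + s)
three-k-≤-square n k 0 s q k≤ 3q≤ _ = three-k-≤-square-generic k 0 s q k≤ 3q≤ z≤n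
three-k-≤-square n k d@(suc _) s@(suc _) q k≤ 3q≤ _ =
  three-k-≤-square-generic k d s q k≤ 3q≤
    (subst (_≤ d * d + 2 * d * s) (triple d) (+-mono-≤ (m≤m*n d d) (*-monoʳ-≤ (2 * d) (s≤s z≤n))))
  where
  triple : ∀ d → d + 2 * d * 1 ≡ 3 * d
  triple = solve-∀
three-k-≤-square n k d@(suc (suc (suc d′))) s q k≤ 3q≤ _ =
  three-k-≤-square-generic k d s q k≤ 3q≤ (≤-trans (*-monoˡ-≤ d (m≤m+n 3 d′)) (m≤m+n (d * d) _))
three-k-≤-square n 0 1 0 0 _ _ _ = z≤n
three-k-≤-square n 1 1 0 0 _ _ 2≡3n = contradiction (multiple-of-three-mod n (sym 2≡3n)) λ ()
three-k-≤-square n 0 2 0 0 _ _ _ = z≤n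
three-k-≤-square n 1 2 0 0 _ _ _ = ≤ᵇ⇒≤ 3 4 _
three-k-≤-square n 2 2 0 0 _ _ 4≡3n = contradiction (multiple-of-three-mod n (sym 4≡3n)) λ ()
three-k-≤-square n (suc (suc (suc k))) 2 0 0 (s≤s (s≤s ())) _ _
three-k-≤-square n (suc (suc k)) 1 0 0 (s≤s ()) _ _
three-k-≤-square n k (suc d) 0 (suc q) _ () _

-- With A = X + Y + Z, d = A − k, s = x + y + z and
-- q = yz + xz + xy we get k + d + s = 3n, k ≤ d + q and 3q ≤ s², hence 3k ≤ (d + s)².
bound-from-counts : ∀ n k X Y Z x y z → X + x ≡ n → Y + y ≡ n → Z + z ≡ n →
                    k ≤ X + Y + Z → 2 * k ≤ X + Y + Z + (y * z + x * z + x * y) →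
                    AtMostBound n k
bound-from-counts n k X Y Z x y z X+x≡n Y+y≡n Z+z≡n k≤A 2k≤A+q =
  bound-from-square n k (d + s) (trans (sym (+-assoc k d s)) k+d+s≡3n)
    (three-k-≤-square n k d s q k≤d+q (three-products-≤-square x y z) k+d+s≡3n)
  where
  A = X + Y + Z
  s = x + y + z
  q = y * z + x * z + x * y
  d = A ∸ k

  k+d≡A : k + d ≡ A
  k+d≡A = m+[n∸m]≡n k≤A

  k+d+s≡3n : k + d + s ≡ 3 * n
  k+d+s≡3n = begin
    k + d + s                     ≡⟨ cong (_+ s) k+d≡A ⟩
    X + Y + Z + (x + y + z)       ≡⟨ regroup X Y Z x y z ⟩
    (X + x) + (Y + y) + (Z + z)   ≡⟨ cong₂ (λ a b → a + b + (Z + z)) X+x≡n Y+y≡n ⟩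
    n + n + (Z + z)               ≡⟨ cong (n + n +_) Z+z≡n ⟩
    n + n + n                     ≡⟨ solve (n ∷ []) ⟩
    3 * n                         ∎
    where
    open ≡-Reasoning
    regroup : ∀ X Y Z x y z → X + Y + Z + (x + y + z) ≡ (X + x) + (Y + y) + (Z + z)
    regroup = solve-∀

  k≤d+q : k ≤ d + q
  k≤d+q = +-cancelˡ-≤ k k (d + q) (begin
    k + k       ≡⟨ cong (k +_) (sym (+-identityʳ k)) ⟩
    2 * k       ≤⟨ 2k≤A+q ⟩
    A + q       ≡⟨ cong (_+ q) (sym k+d≡A) ⟩
    k + d + q   ≡⟨ +-assoc k d q ⟩
    k + (d + q) ∎)
    where open ≤-Reasoning

∑-mono : ∀ {n} {f g : Fin n → ℕ} → (∀ i → f i ≤ g i) → ∑[ i < n ] f i ≤ ∑[ i < n ] g i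
∑-mono {zero}  f≤g = z≤n
∑-mono {suc n} f≤g = +-mono-≤ (f≤g zero) (∑-mono (f≤g ∘ suc))

∑-*ˡ : ∀ {n} m (f : Fin n → ℕ) → ∑[ i < n ] (m * f i) ≡ m * ∑[ i < n ] f i
∑-*ˡ m f = sym (*-distribˡ-sum m f)

∑-*ʳ : ∀ {n} m (f : Fin n → ℕ) → ∑[ i < n ] (f i * m) ≡ (∑[ i < n ] f i) * m
∑-*ʳ m f = sym (*-distribʳ-sum m f)

∑-ones : ∀ n → ∑[ i < n ] 1 ≡ n
∑-ones zero    = refl
∑-ones (suc n) = cong suc (∑-ones n)

∑-zero : ∀ {n} (g : Fin n → ℕ) → (∀ j → g j ≡ 0) → ∑[ j < n ] g j ≡ 0
∑-zero {n} g vanish = trans (sum-cong-≗ vanish) (sum-replicate-zero n)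

∑-single : ∀ {n} (g : Fin n → ℕ) b → (∀ j → j ≢ b → g j ≡ 0) → ∑[ j < n ] g j ≡ g b
∑-single {suc n} g b vanish = begin
  ∑[ j < suc n ] g j                 ≡⟨ sum-remove {i = b} g ⟩
  g b + ∑[ j < n ] g (punchIn b j)   ≡⟨ cong (g b +_) (∑-zero _ (λ j → vanish _ (punchInᵢ≢i b j))) ⟩
  g b + 0                            ≡⟨ +-identityʳ (g b) ⟩
  g b                                ∎
  where open ≡-Reasoning

∑∑-single : ∀ {n} (g : Fin n → Fin n → ℕ) a b → (∀ i j → ¬ (i ≡ a × j ≡ b) → g i j ≡ 0) →
            ∑[ i < n ] ∑[ j < n ] g i j ≡ g a b
∑∑-single g a b vanish =
  trans (∑-single _ a (λ i i≢a → ∑-zero (g i) (λ j → vanish i j (i≢a ∘ proj₁))))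
        (∑-single (g a) b (λ j j≢b → vanish a j (j≢b ∘ proj₂)))

∑-bijection : ∀ {n} (σ : Fin n → Fin n) → Bijective _≡_ _≡_ σ → (g : Fin n → ℕ) →
              ∑[ i < n ] g (σ i) ≡ ∑[ i < n ] g i
∑-bijection σ bij g = sym (∑-permute g (⤖⇒↔ (mk⤖ bij)))

-- Defs measures sizes by list sums over allFin; these agree with ∑.
listSum-tabulate : ∀ {m n} (g : Fin m → Fin n) (f : Fin n → ℕ) →
                   listSum (List.map f (List.tabulate g)) ≡ ∑[ i < m ] f (g i)
listSum-tabulate {zero}  g f = refl
listSum-tabulate {suc m} g f = cong (f (g zero) +_) (listSum-tabulate (g ∘ suc) f)

-- If each map σ i is a bijection, ∑ᵢ ∑ⱼ f i · g (σ i j) = (∑ f)(∑ g): for fixed i the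
-- inner sum runs over all values of g.
∑-product : ∀ {n} (σ : Fin n → Fin n → Fin n) → (∀ i → Bijective _≡_ _≡_ (σ i)) →
            (f g : Fin n → ℕ) →
            ∑[ i < n ] ∑[ j < n ] (f i * g (σ i j)) ≡ (∑[ i < n ] f i) * (∑[ t < n ] g t)
∑-product {n} σ bij f g = begin
  ∑[ i < n ] ∑[ j < n ] (f i * g (σ i j))  ≡⟨ sum-cong-≗ (λ i → ∑-*ˡ (f i) (g ∘ σ i)) ⟩
  ∑[ i < n ] (f i * ∑[ j < n ] g (σ i j))  ≡⟨ sum-cong-≗ (λ i → cong (f i *_) (∑-bijection (σ i) (bij i) g)) ⟩
  ∑[ i < n ] (f i * ∑[ t < n ] g t)        ≡⟨ ∑-*ʳ _ f ⟩
  (∑[ i < n ] f i) * (∑[ t < n ] g t)      ∎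
  where open ≡-Reasoning

ind : Bool → ℕ
ind b = if b then 1 else 0

∑-delta : ∀ {n} b (u : Fin n) (g : Fin n → ℕ) → ∑[ t < n ] (ind (b ∧ ⌊ u ≟ t ⌋) * g t) ≡ ind b * g u
∑-delta b u g = trans (∑-single _ u vanish) (cong (λ c → ind c * g u) b∧[u≟u]≡b)
  where
  vanish : ∀ t → t ≢ u → ind (b ∧ ⌊ u ≟ t ⌋) * g t ≡ 0
  vanish t t≢u with u ≟ t
  ... | yes u≡t = contradiction (sym u≡t) t≢u
  ... | no _ rewrite ∧-zeroʳ b = refl
  b∧[u≟u]≡b : b ∧ ⌊ u ≟ u ⌋ ≡ b
  b∧[u≟u]≡b with u ≟ u
  ... | yes _ = ∧-identityʳ b
  ... | no u≢u = contradiction refl u≢u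

-- A family of n parallel lines of the n × n grid: cell (i , j) lies on line ℓ i j.
-- Rows, columns and (for a Latin square L) symbols are the three families; note that
-- a Latin square is itself a line family.
LineFamily : ℕ → Set
LineFamily n = Fin n → Fin n → Fin n

rowLines columnLines : ∀ {n} → LineFamily n
rowLines i j = i
columnLines i j = j

Meets : ∀ {n} → LineFamily n → EntrySet n → Set
Meets ℓ C = ∀ t → ∃₂ λ i j → C i j ≡ true × ℓ i j ≡ t

cover⇒meets : ∀ {n} {L : Square n} {C : EntrySet n} → IsCover L C →
              Meets rowLines C × Meets columnLines C × Meets L C
cover⇒meets (rows , columns , symbols) =
  (λ t → let (j , Ctj) = rows t in t , j , Ctj , refl) ,
  (λ t → let (i , Cit) = columns t in i , t , Cit , refl) ,
  symbols

meets⇒cover : ∀ {n} {L : Square n} {C : EntrySet n} →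
              Meets rowLines C → Meets columnLines C → Meets L C → IsCover L C
meets⇒cover {C = C} rows columns symbols = rows′ , columns′ , symbols
  where
  rows′ : ∀ t → ∃ λ j → C t j ≡ true
  rows′ t with rows t
  ... | _ , j , Cij , refl = j , Cij
  columns′ : ∀ t → ∃ λ i → C i t ≡ true
  columns′ t with columns t
  ... | i , _ , Cij , refl = i , Cij

remove-other : ∀ {n} (C : EntrySet n) {a b i j} → ¬ (i ≡ a × j ≡ b) → remove C a b i j ≡ C i j
remove-other C {a} {b} {i} {j} ij≢ab with i ≟ a | j ≟ b
... | yes i≡a | yes j≡b = contradiction (i≡a , j≡b) ij≢ab
... | yes _   | no _    = refl
... | no _    | _       = refl

module Counting {n} (C : EntrySet n) where

  entries : ℕ
  entries = ∑[ i < n ] ∑[ j < n ] ind (C i j)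

  weight : (Fin n → Fin n → ℕ) → ℕ
  weight w = ∑[ i < n ] ∑[ j < n ] (ind (C i j) * w i j)

  count : LineFamily n → Fin n → ℕ
  count ℓ t = ∑[ i < n ] ∑[ j < n ] ind (C i j ∧ ⌊ ℓ i j ≟ t ⌋)

  critical : LineFamily n → Fin n → Bool
  critical ℓ t = ⌊ count ℓ t ℕ.≟ 1 ⌋

  χcritical χordinary : LineFamily n → Fin n → ℕ
  χcritical ℓ t = ind (critical ℓ t)
  χordinary ℓ t = ind (not (critical ℓ t))

  #critical #ordinary : LineFamily n → ℕ
  #critical ℓ = ∑[ t < n ] χcritical ℓ t
  #ordinary ℓ = ∑[ t < n ] χordinary ℓ t

  critical+ordinary : ∀ ℓ → #critical ℓ + #ordinary ℓ ≡ n
  critical+ordinary ℓ = begin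
    #critical ℓ + #ordinary ℓ                            ≡⟨ ∑-distrib-+ (χcritical ℓ) (χordinary ℓ) ⟨
    ∑[ t < n ] (χcritical ℓ t + χordinary ℓ t)           ≡⟨ sum-cong-≗ (λ t → ind+ind-not (critical ℓ t)) ⟩
    ∑[ t < n ] 1                                         ≡⟨ ∑-ones n ⟩
    n                                                    ∎
    where
    open ≡-Reasoning
    ind+ind-not : ∀ b → ind b + ind (not b) ≡ 1
    ind+ind-not true  = refl
    ind+ind-not false = refl

  weight-+ : ∀ f g → weight (λ i j → f i j + g i j) ≡ weight f + weight g
  weight-+ f g = begin
    ∑[ i < n ] ∑[ j < n ] (ind (C i j) * (f i j + g i j))      ≡⟨ sum-cong-≗ (λ i → sum-cong-≗ (λ j → *-distribˡ-+ (ind (C i j)) (f i j) (g i j))) ⟩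
    ∑[ i < n ] ∑[ j < n ] (Cf i j + Cg i j)                    ≡⟨ sum-cong-≗ (λ i → ∑-distrib-+ (Cf i) (Cg i)) ⟩
    ∑[ i < n ] (∑[ j < n ] Cf i j + ∑[ j < n ] Cg i j)         ≡⟨ ∑-distrib-+ (λ i → ∑[ j < n ] Cf i j) (λ i → ∑[ j < n ] Cg i j) ⟩
    weight f + weight g                                        ∎
    where
    open ≡-Reasoning
    Cf Cg : Fin n → Fin n → ℕ
    Cf i j = ind (C i j) * f i j
    Cg i j = ind (C i j) * g i j

  weight-mono : ∀ {f g} → (∀ i j → C i j ≡ true → f i j ≤ g i j) → weight f ≤ weight g
  weight-mono {f} {g} f≤g = ∑-mono λ i → ∑-mono λ j → ind-mono (C i j) (f≤g i j)
    where
    ind-mono : ∀ b {x y} → (b ≡ true → x ≤ y) → ind b * x ≤ ind b * y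
    ind-mono true  x≤y = *-monoʳ-≤ 1 (x≤y refl)
    ind-mono false _   = z≤n

  weight-≤-total : ∀ w → weight w ≤ ∑[ i < n ] ∑[ j < n ] w i j
  weight-≤-total w = ∑-mono λ i → ∑-mono λ j → ind-≤ (C i j)
    where
    ind-≤ : ∀ b {x} → ind b * x ≤ x
    ind-≤ true  = ≤-reflexive (*-identityˡ _)
    ind-≤ false = z≤n

  weight-const : ∀ m → weight (λ _ _ → m) ≡ m * entries
  weight-const m = begin
    ∑[ i < n ] ∑[ j < n ] (ind (C i j) * m)   ≡⟨ sum-cong-≗ (λ i → ∑-*ʳ m (ind ∘ C i)) ⟩
    ∑[ i < n ] (∑[ j < n ] ind (C i j) * m)   ≡⟨ ∑-*ʳ m (λ i → ∑[ j < n ] ind (C i j)) ⟩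
    entries * m                               ≡⟨ *-comm entries m ⟩
    m * entries                               ∎
    where open ≡-Reasoning

  weight-by-lines : ∀ ℓ (g : Fin n → ℕ) → weight (λ i j → g (ℓ i j)) ≡ ∑[ t < n ] (count ℓ t * g t)
  weight-by-lines ℓ g = begin
    ∑[ i < n ] ∑[ j < n ] (ind (C i j) * g (ℓ i j))                ≡⟨ sum-cong-≗ (λ i → sum-cong-≗ (λ j → ∑-delta (C i j) (ℓ i j) g)) ⟨
    ∑[ i < n ] ∑[ j < n ] ∑[ t < n ] (δ i j t * g t)               ≡⟨ sum-cong-≗ (λ i → ∑-comm (λ j t → δ i j t * g t)) ⟩
    ∑[ i < n ] ∑[ t < n ] ∑[ j < n ] (δ i j t * g t)               ≡⟨ ∑-comm (λ i t → ∑[ j < n ] (δ i j t * g t)) ⟩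
    ∑[ t < n ] ∑[ i < n ] ∑[ j < n ] (δ i j t * g t)               ≡⟨ sum-cong-≗ (λ t → sum-cong-≗ (λ i → ∑-*ʳ (g t) (λ j → δ i j t))) ⟩
    ∑[ t < n ] ∑[ i < n ] ((∑[ j < n ] δ i j t) * g t)             ≡⟨ sum-cong-≗ (λ t → ∑-*ʳ (g t) (λ i → ∑[ j < n ] δ i j t)) ⟩
    ∑[ t < n ] (count ℓ t * g t)                                   ∎
    where
    open ≡-Reasoning
    δ : Fin n → Fin n → Fin n → ℕ
    δ i j t = ind (C i j ∧ ⌊ ℓ i j ≟ t ⌋)

  -- Each critical line carries exactly one entry, so counting entries by the critical
  -- line through them counts the critical lines.
  weight-critical : ∀ ℓ → weight (λ i j → χcritical ℓ (ℓ i j)) ≡ #critical ℓ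
  weight-critical ℓ = trans (weight-by-lines ℓ (χcritical ℓ)) (sum-cong-≗ (λ t → single (count ℓ t)))
    where
    single : ∀ m → m * ind ⌊ m ℕ.≟ 1 ⌋ ≡ ind ⌊ m ℕ.≟ 1 ⌋
    single m with m ℕ.≟ 1
    ... | yes refl = refl
    ... | no _     = *-zeroʳ m

  another-entry : ∀ ℓ {a b} → C a b ≡ true → count ℓ (ℓ a b) ≢ 1 →
                  ∃₂ λ i j → ¬ (i ≡ a × j ≡ b) × C i j ≡ true × ℓ i j ≡ ℓ a b
  another-entry ℓ {a} {b} Cab count≢1
    with any? (λ i → any? (λ j → ¬? ((i ≟ a) ×-dec (j ≟ b)) ×-dec (C i j Bool.≟ true) ×-dec (ℓ i j ≟ ℓ a b)))
  ... | yes (i , j , other) = i , j , other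
  ... | no none = contradiction count≡1 count≢1
    where
    vanish : ∀ i j → ¬ (i ≡ a × j ≡ b) → ind (C i j ∧ ⌊ ℓ i j ≟ ℓ a b ⌋) ≡ 0
    vanish i j ij≢ab with C i j in Cij | ℓ i j ≟ ℓ a b
    ... | true  | yes same = contradiction (i , j , ij≢ab , Cij , same) none
    ... | true  | no _     = refl
    ... | false | _        = refl
    at-ab : ind (C a b ∧ ⌊ ℓ a b ≟ ℓ a b ⌋) ≡ 1
    at-ab rewrite Cab with ℓ a b ≟ ℓ a b
    ... | yes _    = refl
    ... | no ℓ≢ℓ   = contradiction refl ℓ≢ℓ
    count≡1 : count ℓ (ℓ a b) ≡ 1
    count≡1 = trans (∑∑-single _ a b vanish) at-ab

  meets-after-removal : ∀ ℓ {a b} → Meets ℓ C → C a b ≡ true → count ℓ (ℓ a b) ≢ 1 →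
                        Meets ℓ (remove C a b)
  meets-after-removal ℓ {a} {b} meets Cab count≢1 t with meets t
  ... | i , j , Cij , ℓij≡t with (i ≟ a) ×-dec (j ≟ b)
  ...   | no ij≢ab = i , j , trans (remove-other C ij≢ab) Cij , ℓij≡t
  ...   | yes (refl , refl) with another-entry ℓ Cab count≢1
  ...     | i′ , j′ , i′j′≢ab , Ci′j′ , same = i′ , j′ , trans (remove-other C i′j′≢ab) Ci′j′ , trans same ℓij≡t

-- Through every entry of a minimal cover passes a critical line (r ∨ c ∨ s below).
-- Weighting such an entry by the number of critical lines through it gives at least 1;
-- adding, for each pair of the three lines, 1 when both lines are non-critical gives
-- at least 2 (if only one line is critical, the other two form such a pair).
one-≤-criticals : ∀ r c s → r ∨ c ∨ s ≡ true → 1 ≤ ind r + ind c + ind s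
one-≤-criticals true  _     _    _ = s≤s z≤n
one-≤-criticals false true  _    _ = s≤s z≤n
one-≤-criticals false false true _ = s≤s z≤n

two-≤-criticals+pairs : ∀ r c s → r ∨ c ∨ s ≡ true →
  2 ≤ ind r + ind c + ind s +
      (ind (not c) * ind (not s) + ind (not r) * ind (not s) + ind (not r) * ind (not c))
two-≤-criticals+pairs true  true  true  _ = ≤ᵇ⇒≤ _ _ _
two-≤-criticals+pairs true  true  false _ = ≤ᵇ⇒≤ _ _ _
two-≤-criticals+pairs true  false true  _ = ≤ᵇ⇒≤ _ _ _
two-≤-criticals+pairs true  false false _ = ≤ᵇ⇒≤ _ _ _
two-≤-criticals+pairs false true  true  _ = ≤ᵇ⇒≤ _ _ _
two-≤-criticals+pairs false true  false _ = ≤ᵇ⇒≤ _ _ _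
two-≤-criticals+pairs false false true  _ = ≤ᵇ⇒≤ _ _ _

module _ {n} (L : Square n) (C : EntrySet n) where
  open Counting C

  critical-lines pairs-of-ordinary-lines : Fin n → Fin n → ℕ
  critical-lines i j =
    χcritical rowLines i + χcritical columnLines j + χcritical L (L i j)
  pairs-of-ordinary-lines i j =
    χordinary columnLines j * χordinary L (L i j) + χordinary rowLines i * χordinary L (L i j) +
    χordinary rowLines i * χordinary columnLines j

  weight-critical-lines :
    weight critical-lines ≡ #critical rowLines + #critical columnLines + #critical L
  weight-critical-lines = begin
    weight critical-lines
      ≡⟨ weight-+ (λ i j → R i j + K i j) S ⟩
    weight (λ i j → R i j + K i j) + weight S
      ≡⟨ cong (_+ weight S) (weight-+ R K) ⟩
    weight R + weight K + weight S
      ≡⟨ cong₂ _+_ (cong₂ _+_ (weight-critical rowLines) (weight-critical columnLines)) (weight-critical L) ⟩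
    #critical rowLines + #critical columnLines + #critical L ∎
    where
    open ≡-Reasoning
    R K S : Fin n → Fin n → ℕ
    R i j = χcritical rowLines i
    K i j = χcritical columnLines j
    S i j = χcritical L (L i j)

  -- In a Latin square two lines of different kinds meet in exactly one cell, so the
  -- entries lying on two non-critical lines of given kinds are at most the product of
  -- the numbers of such lines.
  weight-pairs-of-ordinary-lines : IsLatin L →
    weight pairs-of-ordinary-lines ≤
    #ordinary columnLines * #ordinary L + #ordinary rowLines * #ordinary L +
    #ordinary rowLines * #ordinary columnLines
  weight-pairs-of-ordinary-lines (rows-bijective , columns-bijective) = begin
    weight pairs-of-ordinary-lines
      ≡⟨ weight-+ (λ i j → KS i j + RS i j) RK ⟩
    weight (λ i j → KS i j + RS i j) + weight RK
      ≡⟨ cong (_+ weight RK) (weight-+ KS RS) ⟩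
    weight KS + weight RS + weight RK
      ≤⟨ +-mono-≤ (+-mono-≤ (weight-≤-total KS) (weight-≤-total RS)) (weight-≤-total RK) ⟩
    ∑[ i < n ] ∑[ j < n ] KS i j + ∑[ i < n ] ∑[ j < n ] RS i j + ∑[ i < n ] ∑[ j < n ] RK i j
      ≡⟨ cong₂ _+_ (cong₂ _+_ (trans (∑-comm KS) (∑-product (λ j i → L i j) columns-bijective oK oS))
                              (∑-product L rows-bijective oR oS))
                   (∑-product (λ i j → j) (λ _ → bijective _≡_) oR oK) ⟩
    #ordinary columnLines * #ordinary L + #ordinary rowLines * #ordinary L +
    #ordinary rowLines * #ordinary columnLines ∎
    where
    open ≤-Reasoning
    oR oK oS : Fin n → ℕ
    oR = χordinary rowLines
    oK = χordinary columnLines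
    oS = χordinary L
    KS RS RK : Fin n → Fin n → ℕ
    KS i j = oK j * oS (L i j)
    RS i j = oR i * oS (L i j)
    RK i j = oR i * oK j

  -- Minimality: if no line through the entry (a , b) were critical, every line would
  -- still be met after removing it.
  critical-line-through : IsMinimalCover L C → ∀ {a b} → C a b ≡ true →
    critical rowLines a ∨ critical columnLines b ∨ critical L (L a b) ≡ true
  critical-line-through (cover , minimal) {a} {b} Cab
    with critical rowLines a in row | critical columnLines b in column | critical L (L a b) in symbol
  ... | true  | _     | _     = refl
  ... | false | true  | _     = refl
  ... | false | false | true  = refl
  ... | false | false | false = contradiction (meets⇒cover
        (meets-after-removal rowLines meets-rows Cab (not-critical row))
        (meets-after-removal columnLines meets-columns Cab (not-critical column))
        (meets-after-removal L meets-symbols Cab (not-critical symbol)))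
        (minimal a b Cab)
    where
    meets-rows = proj₁ (cover⇒meets cover)
    meets-columns = proj₁ (proj₂ (cover⇒meets cover))
    meets-symbols = proj₂ (proj₂ (cover⇒meets cover))
    not-critical : ∀ {ℓ t} → critical ℓ t ≡ false → count ℓ t ≢ 1
    not-critical {ℓ} {t} not-crit count≡1 with count ℓ t ℕ.≟ 1
    ... | yes _ = case not-crit of λ ()
    ... | no count≢1 = count≢1 count≡1

  -- First count: every entry lies on a critical line, which contains no other entry.
  entries-≤-critical : IsMinimalCover L C →
    entries ≤ #critical rowLines + #critical columnLines + #critical L
  entries-≤-critical minimal = begin
    entries                       ≡⟨ *-identityˡ entries ⟨
    1 * entries                   ≡⟨ weight-const 1 ⟨
    weight (λ _ _ → 1)            ≤⟨ weight-mono (λ i j Cij → one-≤-criticals (critical rowLines i) (critical columnLines j) (critical L (L i j))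
                                (critical-line-through minimal Cij)) ⟩
    weight critical-lines         ≡⟨ weight-critical-lines ⟩
    #critical rowLines + #critical columnLines + #critical L ∎
    where open ≤-Reasoning

  twice-entries-≤ : IsLatin L → IsMinimalCover L C →
    2 * entries ≤ #critical rowLines + #critical columnLines + #critical L +
                  (#ordinary columnLines * #ordinary L + #ordinary rowLines * #ordinary L +
                   #ordinary rowLines * #ordinary columnLines)
  twice-entries-≤ latin minimal = begin
    2 * entries                   ≡⟨ weight-const 2 ⟨
    weight (λ _ _ → 2)            ≤⟨ weight-mono (λ i j Cij → two-≤-criticals+pairs (critical rowLines i) (critical columnLines j) (critical L (L i j))
                                (critical-line-through minimal Cij)) ⟩
    weight (λ i j → critical-lines i j + pairs-of-ordinary-lines i j)
                                  ≡⟨ weight-+ critical-lines pairs-of-ordinary-lines ⟩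
    weight critical-lines + weight pairs-of-ordinary-lines
                                  ≤⟨ +-mono-≤ (≤-reflexive weight-critical-lines) (weight-pairs-of-ordinary-lines latin) ⟩
    #critical rowLines + #critical columnLines + #critical L +
      (#ordinary columnLines * #ordinary L + #ordinary rowLines * #ordinary L +
       #ordinary rowLines * #ordinary columnLines) ∎
    where open ≤-Reasoning

size≡entries : ∀ {n} (C : EntrySet n) → size C ≡ Counting.entries C
size≡entries {n} C =
  trans (listSum-tabulate id (λ i → listSum (List.map (ind ∘ C i) (List.tabulate id))))
        (sum-cong-≗ λ i → listSum-tabulate id (ind ∘ C i))

theorem3p3 : (n : ℕ) (L : Square n) → IsLatin L →
    (C : EntrySet n) → IsMinimalCover L C → AtMostBound n (size C)
theorem3p3 n L latin C minimal =
  subst (AtMostBound n) (sym (size≡entries C))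
    (bound-from-counts n entries
      (#critical rowLines) (#critical columnLines) (#critical L)
      (#ordinary rowLines) (#ordinary columnLines) (#ordinary L)
      (critical+ordinary rowLines) (critical+ordinary columnLines) (critical+ordinary L)
      (entries-≤-critical L C minimal) (twice-entries-≤ L C latin minimal))
  where open Counting C
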